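{- Let $M$ be a finite multiset of words over $A=\{0,1\}$ such that a word $u$ belongs to $M$ if and only if its complement $\bar u$ belongs to $M$, with the same multiplicity. Then for every word $w$ and every $i\ge0$, the multiplicity of $w$ in $f^i(M)$ equals the multiplicity of $\bar w$ in $f^i(M)$.
   Context: $\varphi(0)=01$, $\varphi(1)=10$. The complement $\bar u$ of $u$ is obtained by exchanging $0$ and $1$. A $\varphi$-factorization of $u$ is a factorization $u=w_0\varphi(a_1)w_1\cdots\varphi(a_k)w_k$ with $k\ge1$, $a_i\in A$, $w_i\in A^*$, identified with its tuple of positions $(|w_0|,|w_0\varphi(a_1)w_1|,\ldots)$; for such $\kappa$, $\mathcal{L}(u,\kappa)=A^{|w_0|}a_1A^{|w_1|}\cdots a_kA^{|w_k|}$ (multiplicities $1$). $f(u)$ is the multiset sum of $\mathcal{L}(u,\kappa)$ over all $\varphi$-factorizations of $u$ ($f(u)=\emptyset$ if $u\in0^*\cup1^*$); for a multiset $M$, $f(M)$ is the multiset sum of $f(v)$ over $v\in M$ counted with multiplicity; $f^0(M)=M$, $f^{i+1}=f\circ f^i$. -}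

module Defs where

open import Data.Bool using (Bool; true; false; not; _∨_; if_then_else_; _xor_)
open import Data.Bool.Properties renaming (_≟_ to _≟ᵇ_)
open import Data.Nat using (ℕ; zero; suc)
open import Data.List using (List; []; _∷_; _++_; map; concatMap; filterᵇ; length)
import Data.List.Properties as LP
open import Relation.Nullary using (does)

-- Alphabet A = {0,1} is Bool (false = 0, true = 1); words are List Bool.
Word : Set
Word = List Bool

compl : Word → Word
compl = map not

φ : Bool → Word
φ a = a ∷ not a ∷ []

-- A φ-factorization u = w₀ φ(a₁) w₁ ⋯ φ(a_k) w_k is encoded (bijectively)
-- as the sequence of its pieces: single letters of the wᵢ, and the blocks φ(aᵢ).
data Piece : Set where
  free : Bool → Piece
  phi  : Bool → Piece

flatten : List Piece → Word
flatten [] = []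
flatten (free b ∷ ps) = b ∷ flatten ps
flatten (phi a ∷ ps) = φ a ++ flatten ps

hasPhi : List Piece → Bool
hasPhi [] = false
hasPhi (free _ ∷ ps) = hasPhi ps
hasPhi (phi _ ∷ ps) = true

-- all decompositions ps with flatten ps ≡ u (each exactly once)
decomps : Word → List (List Piece)
decomps [] = [] ∷ []
decomps (x ∷ []) = (free x ∷ []) ∷ []
decomps (x ∷ y ∷ r) =
  map (free x ∷_) (decomps (y ∷ r))
  ++ (if x xor y then map (phi x ∷_) (decomps r) else [])

factorizations : Word → List (List Piece)
factorizations u = filterᵇ hasPhi (decomps u)

-- L(u,κ) = A^{|w₀|} a₁ A^{|w₁|} ⋯ a_k A^{|w_k|}, each word with multiplicity 1
lang : List Piece → List Word
lang [] = [] ∷ []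
lang (free _ ∷ ps) = map (false ∷_) (lang ps) ++ map (true ∷_) (lang ps)
lang (phi a ∷ ps) = map (a ∷_) (lang ps)

-- finite multisets of words are lists (multiplicity = number of occurrences)
Multiset : Set
Multiset = List Word

mult : Word → Multiset → ℕ
mult w M = length (filterᵇ (λ v → does (LP.≡-dec _≟ᵇ_ w v)) M)

f : Word → Multiset
f u = concatMap lang (factorizations u)

fM : Multiset → Multiset
fM M = concatMap f M

fIter : ℕ → Multiset → Multiset
fIter zero M = M
fIter (suc i) M = fM (fIter i M)

-- Complementing a φ-factorization of u piece by piece gives a φ-factorization
-- of ū, since φ(ā) is the complement of φ(a); its language is the complement
-- of the original one, because the free letters range over both values anyway.
-- So f(ū) is a rearrangement of the complement of f(u), and f maps a multiset
-- that is a permutation of its own complement (which is what the hypothesis on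
-- multiplicities says) to another such multiset.
module Submission where

open import Defs
open import Data.Bool using (Bool; true; false; not; _xor_; if_then_else_)
open import Data.Bool.Properties using (not-involutive) renaming (_≟_ to _≟ᵇ_)
open import Data.Empty using (⊥-elim)
open import Data.List using (List; []; _∷_; _++_; map; concatMap; filterᵇ)
import Data.List.Properties as List
open import Data.List.Membership.Propositional using (_∈_)
open import Data.List.Membership.Propositional.Properties using (∈-∃++)
open import Data.List.Relation.Binary.Permutation.Propositional as ↭
  using (_↭_; ↭-refl; ↭-sym; ↭-trans; prep; module PermutationReasoning)
open import Data.List.Relation.Binary.Permutation.Propositional.Properties
  using (map⁺; ++⁺; ++⁺ˡ; ++-comm; shift; shifts; filter-↭; ↭-length)
open import Data.List.Relation.Unary.Any using (here; there)
open import Data.Nat using (ℕ; zero; suc)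
open import Data.Nat.Properties using (suc-injective)
open import Data.Product using (_,_)
open import Function using (_∘_)
open import Relation.Binary.Definitions using (DecidableEquality)
open import Relation.Binary.PropositionalEquality
  using (_≡_; refl; sym; trans; cong; cong₂; module ≡-Reasoning)
open import Relation.Nullary using (yes; no)

_≟ʷ_ : DecidableEquality Word
_≟ʷ_ = List.≡-dec _≟ᵇ_

mult-resp-↭ : ∀ w {M N} → M ↭ N → mult w M ≡ mult w N
mult-resp-↭ w M↭N = ↭-length (filter-↭ _ M↭N)

mult-∷-self : ∀ w M → mult w (w ∷ M) ≡ suc (mult w M)
mult-∷-self w M with w ≟ʷ w
... | yes _ = refl
... | no w≢w = ⊥-elim (w≢w refl)

mult-∷-cancel : ∀ u x {A B} → mult u (x ∷ A) ≡ mult u (x ∷ B) → mult u A ≡ mult u B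
mult-∷-cancel u x eq with u ≟ʷ x
... | yes _ = suc-injective eq
... | no _ = eq

mult≡suc⇒∈ : ∀ w M {k} → mult w M ≡ suc k → w ∈ M
mult≡suc⇒∈ w (v ∷ M) eq with w ≟ʷ v
... | yes w≡v = here w≡v
... | no _ = there (mult≡suc⇒∈ w M eq)

mult-map-involutive : ∀ {g : Word → Word} → (∀ v → g (g v) ≡ v) →
  ∀ w M → mult w (map g M) ≡ mult (g w) M
mult-map-involutive inv w [] = refl
mult-map-involutive {g} inv w (v ∷ M) with w ≟ʷ g v | g w ≟ʷ v
... | yes _ | yes _ = cong suc (mult-map-involutive inv w M)
... | no _ | no _ = mult-map-involutive inv w M
... | yes w≡gv | no gw≢v = ⊥-elim (gw≢v (trans (cong g w≡gv) (inv v)))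
... | no w≢gv | yes gw≡v = ⊥-elim (w≢gv (trans (sym (inv w)) (cong g gw≡v)))

mult≗⇒↭ : ∀ M N → (∀ u → mult u M ≡ mult u N) → M ↭ N
mult≗⇒↭ [] [] _ = ↭-refl
mult≗⇒↭ [] (v ∷ N) same with () ← trans (same v) (mult-∷-self v N)
mult≗⇒↭ (x ∷ M) N same
  with ys , zs , refl ← ∈-∃++ (mult≡suc⇒∈ x N (trans (sym (same x)) (mult-∷-self x M))) =
  ↭-trans (prep x (mult≗⇒↭ M (ys ++ zs) same′)) (↭-sym (shift x ys zs))
  where
  same′ : ∀ u → mult u M ≡ mult u (ys ++ zs)
  same′ u = mult-∷-cancel u x (trans (same u) (mult-resp-↭ u (shift x ys zs)))

concatMap⁺ : ∀ {A B : Set} (g : A → List B) {xs ys} →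
  xs ↭ ys → concatMap g xs ↭ concatMap g ys
concatMap⁺ g ↭.refl = ↭-refl
concatMap⁺ g (↭.prep x p) = ++⁺ˡ (g x) (concatMap⁺ g p)
concatMap⁺ g (↭.swap x y p) =
  ↭-trans (shifts (g x) (g y)) (++⁺ˡ (g y) (++⁺ˡ (g x) (concatMap⁺ g p)))
concatMap⁺ g (↭.trans p q) = ↭-trans (concatMap⁺ g p) (concatMap⁺ g q)

concatMap-cong-↭ : ∀ {A B : Set} {g h : A → List B} →
  (∀ x → g x ↭ h x) → ∀ xs → concatMap g xs ↭ concatMap h xs
concatMap-cong-↭ g↭h [] = ↭-refl
concatMap-cong-↭ g↭h (x ∷ xs) = ++⁺ (g↭h x) (concatMap-cong-↭ g↭h xs)

map-commute : ∀ {A B C D : Set} {g : B → D} {h : A → B} {g′ : C → D} {h′ : A → C} →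
  (∀ x → g (h x) ≡ g′ (h′ x)) → ∀ xs → map g (map h xs) ≡ map g′ (map h′ xs)
map-commute eq xs =
  trans (sym (List.map-∘ xs)) (trans (List.map-cong eq xs) (List.map-∘ xs))

filterᵇ-map-comm : ∀ {A : Set} (p : A → Bool) {g : A → A} →
  (∀ x → p (g x) ≡ p x) → ∀ xs → filterᵇ p (map g xs) ≡ map g (filterᵇ p xs)
filterᵇ-map-comm p inv [] = refl
filterᵇ-map-comm p {g} inv (x ∷ xs) rewrite inv x with p x
... | true = cong (g x ∷_) (filterᵇ-map-comm p inv xs)
... | false = filterᵇ-map-comm p inv xs

compl-involutive : ∀ w → compl (compl w) ≡ w
compl-involutive [] = refl
compl-involutive (b ∷ w) = cong₂ _∷_ (not-involutive b) (compl-involutive w)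

not-xor-not : ∀ x y → (not x xor not y) ≡ (x xor y)
not-xor-not false false = refl
not-xor-not false true = refl
not-xor-not true false = refl
not-xor-not true true = refl

complPiece : Piece → Piece
complPiece (free b) = free (not b)
complPiece (phi a) = phi (not a)

complPieces : List Piece → List Piece
complPieces = map complPiece

hasPhi-complPieces : ∀ ps → hasPhi (complPieces ps) ≡ hasPhi ps
hasPhi-complPieces [] = refl
hasPhi-complPieces (free _ ∷ ps) = hasPhi-complPieces ps
hasPhi-complPieces (phi _ ∷ ps) = refl

decomps-compl : ∀ u → decomps (compl u) ≡ map complPieces (decomps u)
decomps-compl [] = refl
decomps-compl (x ∷ []) = refl
decomps-compl (x ∷ yr@(y ∷ r)) =
  trans (cong₂ _++_ (free-branch (decomps-compl yr)) (phi-branch (decomps-compl r)))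
        (sym (List.map-++ complPieces (map (free x ∷_) (decomps yr)) _))
  where
  free-branch : decomps (compl yr) ≡ map complPieces (decomps yr) →
                map (free (not x) ∷_) (decomps (compl yr))
              ≡ map complPieces (map (free x ∷_) (decomps yr))
  free-branch ih = trans (cong (map _) ih) (map-commute (λ _ → refl) _)

  phi-branch : decomps (compl r) ≡ map complPieces (decomps r) →
               (if not x xor not y then map (phi (not x) ∷_) (decomps (compl r)) else [])
             ≡ map complPieces (if x xor y then map (phi x ∷_) (decomps r) else [])
  phi-branch ih rewrite not-xor-not x y with x xor y
  ... | true = trans (cong (map _) ih) (map-commute (λ _ → refl) _)
  ... | false = refl

lang-complPieces : ∀ ps → lang (complPieces ps) ↭ map compl (lang ps)
lang-complPieces [] = ↭-refl
lang-complPieces (phi a ∷ ps) = begin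
  map (not a ∷_) (lang (complPieces ps))  ↭⟨ map⁺ _ (lang-complPieces ps) ⟩
  map (not a ∷_) (map compl (lang ps))    ≡⟨ map-commute (λ _ → refl) (lang ps) ⟩
  map compl (map (a ∷_) (lang ps))        ∎
  where open PermutationReasoning
-- Complementing a word swaps the half starting with 0 and the half starting with 1.
lang-complPieces (free b ∷ ps) = begin
  map (false ∷_) L′ ++ map (true ∷_) L′
    ↭⟨ ++⁺ (map⁺ _ (lang-complPieces ps)) (map⁺ _ (lang-complPieces ps)) ⟩
  map (false ∷_) (map compl L) ++ map (true ∷_) (map compl L)
    ↭⟨ ++-comm (map (false ∷_) (map compl L)) _ ⟩
  map (true ∷_) (map compl L) ++ map (false ∷_) (map compl L)
    ≡⟨ cong₂ _++_ (map-commute (λ _ → refl) L) (map-commute (λ _ → refl) L) ⟩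
  map compl (map (false ∷_) L) ++ map compl (map (true ∷_) L)
    ≡⟨ List.map-++ compl (map (false ∷_) L) _ ⟨
  map compl (map (false ∷_) L ++ map (true ∷_) L) ∎
  where
  open PermutationReasoning
  L L′ : List Word
  L = lang ps
  L′ = lang (complPieces ps)

f-compl : ∀ u → f (compl u) ↭ map compl (f u)
f-compl u = begin
  concatMap lang (filterᵇ hasPhi (decomps (compl u)))
    ≡⟨ cong (concatMap lang ∘ filterᵇ hasPhi) (decomps-compl u) ⟩
  concatMap lang (filterᵇ hasPhi (map complPieces (decomps u)))
    ≡⟨ cong (concatMap lang) (filterᵇ-map-comm hasPhi hasPhi-complPieces (decomps u)) ⟩
  concatMap lang (map complPieces (factorizations u))
    ≡⟨ List.concatMap-map lang complPieces (factorizations u) ⟩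
  concatMap (lang ∘ complPieces) (factorizations u)
    ↭⟨ concatMap-cong-↭ lang-complPieces (factorizations u) ⟩
  concatMap (map compl ∘ lang) (factorizations u)
    ≡⟨ List.map-concatMap compl lang (factorizations u) ⟨
  map compl (f u) ∎
  where open PermutationReasoning

SelfComplementary : Multiset → Set
SelfComplementary M = M ↭ map compl M

fM-map-compl : ∀ M → fM (map compl M) ↭ map compl (fM M)
fM-map-compl M = begin
  concatMap f (map compl M)         ≡⟨ List.concatMap-map f compl M ⟩
  concatMap (f ∘ compl) M           ↭⟨ concatMap-cong-↭ f-compl M ⟩
  concatMap (map compl ∘ f) M       ≡⟨ List.map-concatMap compl f M ⟨
  map compl (fM M)                  ∎
  where open PermutationReasoning

fM-selfComplementary : ∀ {M} → SelfComplementary M → SelfComplementary (fM M)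
fM-selfComplementary {M} M↭M̄ = ↭-trans (concatMap⁺ f M↭M̄) (fM-map-compl M)

fIter-selfComplementary : ∀ i {M} → SelfComplementary M → SelfComplementary (fIter i M)
fIter-selfComplementary zero sc = sc
fIter-selfComplementary (suc i) sc = fM-selfComplementary (fIter-selfComplementary i sc)

lemma4p1 : (M : Multiset) →
    (∀ u → mult u M ≡ mult (compl u) M) →
    ∀ (w : Word) (i : ℕ) → mult w (fIter i M) ≡ mult (compl w) (fIter i M)
lemma4p1 M symmetric w i = begin
  mult w X              ≡⟨ mult-resp-↭ w (fIter-selfComplementary i M↭M̄) ⟩
  mult w (map compl X)  ≡⟨ mult-map-involutive compl-involutive w X ⟩
  mult (compl w) X      ∎
  where
  open ≡-Reasoning
  X : Multiset
  X = fIter i M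
  M↭M̄ : SelfComplementary M
  M↭M̄ = mult≗⇒↭ M (map compl M) λ u →
    trans (symmetric u) (sym (mult-map-involutive compl-involutive u M))
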